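{- Let $1\le r\le n$ be integers and $b=(b_1,\dots,b_r)\in(\mathbb{N}^*)^r$ with $b_1+\cdots+b_r=n$. Then $$\binom{n}{b_1,\dots,b_r}\sum_{k=r}^{n}\ \sum_{\substack{a_1+\cdots+a_k=n\\ a_i\in\mathbb{N}^*}}(-1)^{n-k}\frac{(n-k)!}{n!\,n^{n-k}\,a_1\cdots a_k}\binom{n-r}{k-r}a_1^{b_1}\cdots a_r^{b_r}=\delta_{nr},$$ where $\delta_{nr}=1$ if $n=r$ and $\delta_{nr}=0$ otherwise.
   Context: $\mathbb{N}^*$ denotes the set of positive integers; $\binom{n}{b_1,\dots,b_r}=\frac{n!}{b_1!\cdots b_r!}$ is the multinomial coefficient. Inner sums run over ordered tuples of positive integers with sum $n$. -}

module Defs where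

open import Data.Nat as ℕ using (ℕ; zero; suc; _∸_; _!)
open import Data.Nat.Combinatorics using (_C_)
import Data.Nat.Properties as ℕP
open import Data.Integer using (+_)
open import Data.Rational using (ℚ; 0ℚ; 1ℚ; _+_; _*_; -_; _/_; 1/_; ≢-nonZero)
open import Data.Rational.Properties using (_≟_)
open import Data.List using (List; []; _∷_; map; concatMap; foldr; upTo; zipWith)
open import Data.Nat.ListAction using (product)
open import Data.Vec using (Vec; toList)
open import Relation.Nullary using (yes; no)

ℕ→ℚ : ℕ → ℚ
ℕ→ℚ m = (+ m) / 1

-- totalised inverse (0⁻¹ = 0); only ever applied to nonzero values below
inv : ℚ → ℚ
inv p with p ≟ 0ℚ
... | yes _ = 0ℚ
... | no p≢0 = 1/_ p {{≢-nonZero p≢0}}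

sumℚ : List ℚ → ℚ
sumℚ = foldr _+_ 0ℚ

sign : ℕ → ℚ
sign zero = 1ℚ
sign (suc m) = - sign m

oneTo : ℕ → List ℕ
oneTo n = map suc (upTo n)

compositions : ℕ → ℕ → List (List ℕ)
compositions zero zero = [] ∷ []
compositions zero (suc n) = []
compositions (suc k) n = concatMap (λ a → map (a ∷_) (compositions k (n ∸ a))) (oneTo n)

multinomial : ℕ → List ℕ → ℚ
multinomial n bs = ℕ→ℚ (n !) * inv (ℕ→ℚ (product (map _! bs)))

-- a₁^{b₁} ⋯ a_r^{b_r}  (a has length k ≥ r; zipWith uses the first r entries of a)
powProd : List ℕ → List ℕ → ℕ
powProd as bs = product (zipWith ℕ._^_ as bs)

term : (n r k : ℕ) → List ℕ → List ℕ → ℚ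
term n r k bs as =
  sign (n ∸ k) * ℕ→ℚ (((n ∸ k) !))
    * inv (ℕ→ℚ (n ! ℕ.* (n ℕ.^ (n ∸ k)) ℕ.* product as))
    * ℕ→ℚ ((n ∸ r) C (k ∸ r))
    * ℕ→ℚ (powProd as bs)

-- the full left-hand side; k ranges over r, r+1, …, n
lhs : (n r : ℕ) → List ℕ → ℚ
lhs n r bs =
  multinomial n bs *
    sumℚ (map (λ k → sumℚ (map (term n r k bs) (compositions k n)))
              (map (r ℕ.+_) (upTo (suc (n ∸ r)))))

δ : ℕ → ℕ → ℚ
δ n r with n ℕP.≟ r
... | yes _ = 1ℚ
... | no _ = 0ℚ

{-# OPTIONS --safe #-}

-- Let ℓ = -log (1 - x) = ∑ xᵃ/a and π_b = ∑ a^(b-1) xᵃ. The sum over compositions of n into k parts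
-- of a₁^b₁ ⋯ a_r^b_r / (a₁ ⋯ a_k) is the xⁿ-coefficient of π_{b₁} ⋯ π_{b_r} ℓ^(k-r). After a common
-- factor is pulled out, the sum over k turns these ℓ-powers into the partial sum of order n - r of
-- exp (-n ℓ) = (1 - x)ⁿ; since π_{b₁} ⋯ π_{b_r} is divisible by xʳ, only coefficients up to order
-- n - r matter, so the partial sum may be replaced by (1 - x)ⁿ = ∏ (1 - x)^{b_i}; both series satisfy
-- (1 - x) θ f = -n x f (θ = x d/dx) up to that order, i.e. (t + 1) f_{t+1} = (t - n) f_t. Each factor
-- π_{b_i} (1 - x)^{b_i} is a polynomial of degree b_i whose top coefficient is 1 if b_i = 1 and 0
-- otherwise; as ∑ b_i = n, the xⁿ-coefficient of the product is nonzero only if every b_i = 1,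
-- i.e. n = r, and then the prefactor makes the whole expression 1.

module Submission where

open import Defs
open import Function using (_∘_)
open import Data.Nat as ℕ using (ℕ; zero; suc; _∸_; _!; _≤_; _<_; z≤n; s≤s)
import Data.Nat.Properties as ℕP
import Data.Integer as ℤ
import Data.Integer.Properties as ℤP
import Data.Nat.Coprimality as Coprime
open import Data.Rational using (ℚ; 0ℚ; 1ℚ; _+_; _*_; -_; _-_; 1/_; mkℚ; _/_; ≢-nonZero)
open import Data.Rational.Properties
open import Data.Rational.Solver using (module +-*-Solver)
open import Data.Nat.Combinatorics using (_C_; nCk≡n!/k![n-k]!; k![n∸k]!∣n!)
open import Data.Nat.DivMod using (m/n*n≡m)
open import Data.Empty using (⊥-elim)
open import Data.List using (List; []; _∷_; drop; length; map; concatMap; _++_; applyUpTo; upTo)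
open import Data.Nat.ListAction using (sum; product)
open import Data.List.Relation.Unary.All using (All; []; _∷_)
open import Data.Vec as Vec using (Vec; toList)
import Data.Vec.Relation.Unary.All as VecAll
open import Data.Vec.Relation.Unary.All.Properties using (toList⁺)
open import Data.Vec.Properties using (length-toList)
open import Data.Sum using (_⊎_; inj₁; inj₂)
open import Data.Product using (_×_; _,_; proj₁; proj₂)
open import Relation.Binary.Definitions using (tri<; tri≈; tri>)
open import Relation.Nullary using (yes; no; Dec)
open import Relation.Binary.PropositionalEquality
open import Data.List.Properties using (map-cong; map-∘)

open +-*-Solver

ℕ→ℚ≡mkℚ : ∀ m → ℕ→ℚ m ≡ mkℚ (ℤ.+ m) 0 (Coprime.sym (Coprime.1-coprimeTo m))
ℕ→ℚ≡mkℚ m = normalize-coprime (Coprime.sym (Coprime.1-coprimeTo m))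

ℕ→ℚ-+ : ∀ a b → ℕ→ℚ (a ℕ.+ b) ≡ ℕ→ℚ a + ℕ→ℚ b
ℕ→ℚ-+ a b rewrite ℕ→ℚ≡mkℚ a | ℕ→ℚ≡mkℚ b =
  cong (_/ 1) (trans (ℤP.pos-+ a b) (sym (cong₂ ℤ._+_ (ℤP.*-identityʳ (ℤ.+ a)) (ℤP.*-identityʳ (ℤ.+ b)))))

ℕ→ℚ-* : ∀ a b → ℕ→ℚ (a ℕ.* b) ≡ ℕ→ℚ a * ℕ→ℚ b
ℕ→ℚ-* a b rewrite ℕ→ℚ≡mkℚ a | ℕ→ℚ≡mkℚ b = cong (_/ 1) (ℤP.pos-* a b)

ℕ→ℚ-suc : ∀ m → ℕ→ℚ (suc m) ≡ 1ℚ + ℕ→ℚ m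
ℕ→ℚ-suc = ℕ→ℚ-+ 1

ℕ→ℚ-≢0 : ∀ m → m ≢ 0 → ℕ→ℚ m ≢ 0ℚ
ℕ→ℚ-≢0 zero m≢0 _ = m≢0 refl
ℕ→ℚ-≢0 (suc m) _ eq with trans (sym (ℕ→ℚ≡mkℚ (suc m))) eq
... | ()

*-inv : ∀ p → p ≢ 0ℚ → p * inv p ≡ 1ℚ
*-inv p p≢0 with p ≟ 0ℚ
... | yes p≡0 = ⊥-elim (p≢0 p≡0)
... | no p≢0′ = *-inverseʳ p {{≢-nonZero p≢0′}}

inv-zero : ∀ {p} → p ≡ 0ℚ → inv p ≡ 0ℚ
inv-zero refl = refl

inv-unique : ∀ p q → p * q ≡ 1ℚ → inv p ≡ q
inv-unique p q pq with p ≟ 0ℚ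
... | yes refl = ⊥-elim (1≢0 (trans (sym pq) (*-zeroˡ q)))
... | no p≢0 = begin
  p⁻¹             ≡⟨ sym (*-identityʳ p⁻¹) ⟩
  p⁻¹ * 1ℚ        ≡⟨ cong (p⁻¹ *_) (sym pq) ⟩
  p⁻¹ * (p * q)   ≡⟨ sym (*-assoc p⁻¹ p q) ⟩
  p⁻¹ * p * q     ≡⟨ cong (_* q) (*-inverseˡ p {{≢-nonZero p≢0}}) ⟩
  1ℚ * q          ≡⟨ *-identityˡ q ⟩
  q               ∎
  where
  open ≡-Reasoning
  p⁻¹ = (1/ p) {{≢-nonZero p≢0}}

inv-* : ∀ p q → inv (p * q) ≡ inv p * inv q
inv-* p q = by-cases (p ≟ 0ℚ) (q ≟ 0ℚ)
  where
  open ≡-Reasoning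
  by-cases : Dec (p ≡ 0ℚ) → Dec (q ≡ 0ℚ) → inv (p * q) ≡ inv p * inv q
  by-cases (yes p≡0) _ = trans (inv-zero (trans (cong (_* q) p≡0) (*-zeroˡ q)))
                               (sym (trans (cong (_* inv q) (inv-zero p≡0)) (*-zeroˡ (inv q))))
  by-cases (no _) (yes q≡0) = trans (inv-zero (trans (cong (p *_) q≡0) (*-zeroʳ p)))
                                    (sym (trans (cong (inv p *_) (inv-zero q≡0)) (*-zeroʳ (inv p))))
  by-cases (no p≢0) (no q≢0) = inv-unique (p * q) (inv p * inv q) (begin
    p * q * (inv p * inv q)   ≡⟨ solve 4 (λ a b c d → a :* b :* (c :* d) := (a :* c) :* (b :* d)) refl p q (inv p) (inv q) ⟩
    p * inv p * (q * inv q)   ≡⟨ cong₂ _*_ (*-inv p p≢0) (*-inv q q≢0) ⟩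
    1ℚ                        ∎)

inv-ℕ→ℚ-* : ∀ a b → inv (ℕ→ℚ (a ℕ.* b)) ≡ inv (ℕ→ℚ a) * inv (ℕ→ℚ b)
inv-ℕ→ℚ-* a b = trans (cong inv (ℕ→ℚ-* a b)) (inv-* (ℕ→ℚ a) (ℕ→ℚ b))

ℕ→ℚ-*-inv : ∀ m .{{_ : ℕ.NonZero m}} → ℕ→ℚ m * inv (ℕ→ℚ m) ≡ 1ℚ
ℕ→ℚ-*-inv m = *-inv (ℕ→ℚ m) (ℕ→ℚ-≢0 m (ℕ.≢-nonZero⁻¹ m))

*-cancelˡ-ℕ→ℚ-suc : ∀ m {x y} → ℕ→ℚ (suc m) * x ≡ ℕ→ℚ (suc m) * y → x ≡ y
*-cancelˡ-ℕ→ℚ-suc m {x} {y} eq = begin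
  x                   ≡⟨ sym (unscale x) ⟩
  m⁻¹ * (m′ * x)      ≡⟨ cong (m⁻¹ *_) eq ⟩
  m⁻¹ * (m′ * y)      ≡⟨ unscale y ⟩
  y                   ∎
  where
  open ≡-Reasoning
  m′ = ℕ→ℚ (suc m)
  m⁻¹ = inv m′
  unscale : ∀ z → m⁻¹ * (m′ * z) ≡ z
  unscale z = trans (solve 3 (λ a b w → b :* (a :* w) := (a :* b) :* w) refl m′ m⁻¹ z)
                    (trans (cong (_* z) (ℕ→ℚ-*-inv (suc m))) (*-identityˡ z))

sign-+ : ∀ a b → sign (a ℕ.+ b) ≡ sign a * sign b
sign-+ zero b = sym (*-identityˡ (sign b))
sign-+ (suc a) b = trans (cong -_ (sign-+ a b)) (neg-distribˡ-* (sign a) (sign b))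

sign-*-sign : ∀ j → sign j * sign j ≡ 1ℚ
sign-*-sign zero = refl
sign-*-sign (suc j) = trans (solve 1 (λ x → (:- x) :* (:- x) := x :* x) refl (sign j)) (sign-*-sign j)

-- Formal power series

∑≤ : ℕ → (ℕ → ℚ) → ℚ
∑≤ zero F = F 0
∑≤ (suc t) F = F 0 + ∑≤ t (F ∘ suc)

∑≤-cong≤ : ∀ t {F G : ℕ → ℚ} → (∀ i → i ≤ t → F i ≡ G i) → ∑≤ t F ≡ ∑≤ t G
∑≤-cong≤ zero F≡G = F≡G 0 z≤n
∑≤-cong≤ (suc t) F≡G = cong₂ _+_ (F≡G 0 z≤n) (∑≤-cong≤ t (λ i i≤t → F≡G (suc i) (s≤s i≤t)))

∑≤-cong : ∀ t {F G : ℕ → ℚ} → F ≗ G → ∑≤ t F ≡ ∑≤ t G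
∑≤-cong t F≗G = ∑≤-cong≤ t (λ i _ → F≗G i)

∑≤-zero : ∀ t (F : ℕ → ℚ) → (∀ i → i ≤ t → F i ≡ 0ℚ) → ∑≤ t F ≡ 0ℚ
∑≤-zero zero F F≡0 = F≡0 0 z≤n
∑≤-zero (suc t) F F≡0 = cong₂ _+_ (F≡0 0 z≤n) (∑≤-zero t (F ∘ suc) (λ i i≤t → F≡0 (suc i) (s≤s i≤t)))

∑≤-+ : ∀ t (F G : ℕ → ℚ) → ∑≤ t (λ i → F i + G i) ≡ ∑≤ t F + ∑≤ t G
∑≤-+ zero F G = refl
∑≤-+ (suc t) F G = trans (cong (F 0 + G 0 +_) (∑≤-+ t (F ∘ suc) (G ∘ suc)))
  (solve 4 (λ a b c d → a :+ b :+ (c :+ d) := a :+ c :+ (b :+ d)) refl (F 0) (G 0) (∑≤ t (F ∘ suc)) (∑≤ t (G ∘ suc)))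

∑≤-*ˡ : ∀ t c (F : ℕ → ℚ) → ∑≤ t (λ i → c * F i) ≡ c * ∑≤ t F
∑≤-*ˡ zero c F = refl
∑≤-*ˡ (suc t) c F = trans (cong (c * F 0 +_) (∑≤-*ˡ t c (F ∘ suc))) (sym (*-distribˡ-+ c (F 0) (∑≤ t (F ∘ suc))))

∑≤-suc : ∀ t (F : ℕ → ℚ) → ∑≤ (suc t) F ≡ ∑≤ t F + F (suc t)
∑≤-suc zero F = refl
∑≤-suc (suc t) F = trans (cong (F 0 +_) (∑≤-suc t (F ∘ suc))) (sym (+-assoc (F 0) (∑≤ t (F ∘ suc)) (F (suc (suc t)))))

∑≤-reverse : ∀ t (F : ℕ → ℚ) → ∑≤ t F ≡ ∑≤ t (λ i → F (t ∸ i))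
∑≤-reverse zero F = refl
∑≤-reverse (suc t) F = begin
  F 0 + ∑≤ t (F ∘ suc)                         ≡⟨ cong (F 0 +_) (∑≤-reverse t (F ∘ suc)) ⟩
  F 0 + ∑≤ t (λ i → F (suc (t ∸ i)))           ≡⟨ +-comm (F 0) _ ⟩
  ∑≤ t (λ i → F (suc (t ∸ i))) + F 0           ≡⟨ cong₂ _+_ (∑≤-cong≤ t (λ i i≤t → cong F (sym (ℕP.+-∸-assoc 1 i≤t))))
                                                          (cong F (sym (ℕP.n∸n≡0 t))) ⟩
  ∑≤ t (λ i → F (suc t ∸ i)) + F (suc t ∸ suc t) ≡⟨ sym (∑≤-suc t (λ i → F (suc t ∸ i))) ⟩
  ∑≤ (suc t) (λ i → F (suc t ∸ i))             ∎
  where open ≡-Reasoning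

∑≤-swap : ∀ t m (K : ℕ → ℕ → ℚ) → ∑≤ t (λ i → ∑≤ m (K i)) ≡ ∑≤ m (λ j → ∑≤ t (λ i → K i j))
∑≤-swap zero m K = refl
∑≤-swap (suc t) m K = trans (cong (∑≤ m (K 0) +_) (∑≤-swap t m (K ∘ suc)))
  (sym (∑≤-+ m (K 0) (λ j → ∑≤ t (λ i → K (suc i) j))))

∑≤-single : ∀ t k (F : ℕ → ℚ) → k ≤ t → (∀ i → i ≤ t → i ≢ k → F i ≡ 0ℚ) → ∑≤ t F ≡ F k
∑≤-single zero zero F _ _ = refl
∑≤-single (suc t) zero F _ F≡0 =
  trans (cong (F 0 +_) (∑≤-zero t (F ∘ suc) (λ i i≤t → F≡0 (suc i) (s≤s i≤t) λ ()))) (+-identityʳ (F 0))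
∑≤-single (suc t) (suc k) F (s≤s k≤t) F≡0 =
  trans (cong (_+ ∑≤ t (F ∘ suc)) (F≡0 0 z≤n λ ()))
        (trans (+-identityˡ _) (∑≤-single t k (F ∘ suc) k≤t
          (λ i i≤t i≢k → F≡0 (suc i) (s≤s i≤t) (i≢k ∘ ℕP.suc-injective))))

Series : Set
Series = ℕ → ℚ

infixl 6 _⊕_
_⊕_ : Series → Series → Series
(f ⊕ g) t = f t + g t

infixr 7 _•_
_•_ : ℚ → Series → Series
(c • f) t = c * f t

infixl 7 _⋆_
_⋆_ : Series → Series → Series
(f ⋆ g) t = ∑≤ t (λ i → f i * g (t ∸ i))

one : Series
one zero = 1ℚ
one (suc _) = 0ℚ

⋆-cong : ∀ {f f′ g g′} → f ≗ f′ → g ≗ g′ → f ⋆ g ≗ f′ ⋆ g′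
⋆-cong f≗f′ g≗g′ t = ∑≤-cong t (λ i → cong₂ _*_ (f≗f′ i) (g≗g′ (t ∸ i)))

⋆-congˡ : ∀ {f f′} g → f ≗ f′ → f ⋆ g ≗ f′ ⋆ g
⋆-congˡ g f≗f′ = ⋆-cong {g = g} {g′ = g} f≗f′ (λ _ → refl)

⋆-congʳ : ∀ f {g g′} → g ≗ g′ → f ⋆ g ≗ f ⋆ g′
⋆-congʳ f = ⋆-cong {f} {f} (λ _ → refl)

⋆-comm : ∀ f g → f ⋆ g ≗ g ⋆ f
⋆-comm f g t = trans (∑≤-reverse t (λ i → f i * g (t ∸ i)))
  (∑≤-cong≤ t (λ i i≤t → trans (cong (λ x → f (t ∸ i) * g x) (ℕP.m∸[m∸n]≡n i≤t)) (*-comm (f (t ∸ i)) (g i))))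

⋆-distribʳ-⊕ : ∀ h f g → (f ⊕ g) ⋆ h ≗ f ⋆ h ⊕ g ⋆ h
⋆-distribʳ-⊕ h f g t = trans (∑≤-cong t (λ i → *-distribʳ-+ (h (t ∸ i)) (f i) (g i))) (∑≤-+ t _ _)

⋆-distribˡ-⊕ : ∀ h f g → h ⋆ (f ⊕ g) ≗ h ⋆ f ⊕ h ⋆ g
⋆-distribˡ-⊕ h f g t = trans (∑≤-cong t (λ i → *-distribˡ-+ (h i) (f (t ∸ i)) (g (t ∸ i)))) (∑≤-+ t _ _)

•-⋆ : ∀ c f g → (c • f) ⋆ g ≗ c • (f ⋆ g)
•-⋆ c f g t = trans (∑≤-cong t (λ i → *-assoc c (f i) (g (t ∸ i)))) (∑≤-*ˡ t c _)

⋆-• : ∀ c f g → f ⋆ (c • g) ≗ c • (f ⋆ g)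
⋆-• c f g t = trans (⋆-comm f (c • g) t) (trans (•-⋆ c g f t) (cong (c *_) (⋆-comm g f t)))

⋆-assoc : ∀ f g h → (f ⋆ g) ⋆ h ≗ f ⋆ (g ⋆ h)
⋆-assoc f g h zero = *-assoc (f 0) (g 0) (h 0)
⋆-assoc f g h (suc t) = begin
  -- (f ⋆ g) (suc i) unfolds to f 0 * g (suc i) + ((f ∘ suc) ⋆ g) i
  f 0 * g 0 * h (suc t) + (((f 0 • (g ∘ suc)) ⊕ (f ∘ suc) ⋆ g) ⋆ h) t
    ≡⟨ cong (f 0 * g 0 * h (suc t) +_) (⋆-distribʳ-⊕ h (f 0 • (g ∘ suc)) ((f ∘ suc) ⋆ g) t) ⟩
  f 0 * g 0 * h (suc t) + (((f 0 • (g ∘ suc)) ⋆ h) t + ((f ∘ suc) ⋆ g ⋆ h) t)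
    ≡⟨ cong₂ (λ x y → f 0 * g 0 * h (suc t) + (x + y)) (•-⋆ (f 0) (g ∘ suc) h t) (⋆-assoc (f ∘ suc) g h t) ⟩
  f 0 * g 0 * h (suc t) + (f 0 * ((g ∘ suc) ⋆ h) t + ((f ∘ suc) ⋆ (g ⋆ h)) t)
    ≡⟨ solve 5 (λ a b c d e → a :* b :* c :+ (a :* d :+ e) := a :* (b :* c :+ d) :+ e) refl
               (f 0) (g 0) (h (suc t)) (((g ∘ suc) ⋆ h) t) (((f ∘ suc) ⋆ (g ⋆ h)) t) ⟩
  f 0 * (g ⋆ h) (suc t) + ((f ∘ suc) ⋆ (g ⋆ h)) t
    ∎
  where open ≡-Reasoning

⋆-leftComm : ∀ f g h → f ⋆ (g ⋆ h) ≗ g ⋆ (f ⋆ h)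
⋆-leftComm f g h t = begin
  (f ⋆ (g ⋆ h)) t ≡⟨ sym (⋆-assoc f g h t) ⟩
  (f ⋆ g ⋆ h) t   ≡⟨ ⋆-congˡ h (⋆-comm f g) t ⟩
  (g ⋆ f ⋆ h) t   ≡⟨ ⋆-assoc g f h t ⟩
  (g ⋆ (f ⋆ h)) t ∎
  where open ≡-Reasoning

⋆-identityˡ : ∀ g → one ⋆ g ≗ g
⋆-identityˡ g zero = *-identityˡ (g 0)
⋆-identityˡ g (suc t) =
  trans (cong₂ _+_ (*-identityˡ (g (suc t))) (∑≤-zero t _ (λ i _ → *-zeroˡ (g (t ∸ i))))) (+-identityʳ (g (suc t)))

⋆-identityʳ : ∀ g → g ⋆ one ≗ g
⋆-identityʳ g t = trans (⋆-comm g one t) (⋆-identityˡ g t)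

⋆-∑≤ : ∀ f m (c : ℕ → ℚ) (G : ℕ → Series) →
  f ⋆ (λ s → ∑≤ m (λ j → c j * G j s)) ≗ λ t → ∑≤ m (λ j → c j * (f ⋆ G j) t)
⋆-∑≤ f m c G t = begin
  ∑≤ t (λ i → f i * ∑≤ m (λ j → c j * G j (t ∸ i)))     ≡⟨ ∑≤-cong t (λ i → sym (∑≤-*ˡ m (f i) _)) ⟩
  ∑≤ t (λ i → ∑≤ m (λ j → f i * (c j * G j (t ∸ i))))   ≡⟨ ∑≤-swap t m _ ⟩
  ∑≤ m (λ j → ∑≤ t (λ i → f i * (c j * G j (t ∸ i))))   ≡⟨ ∑≤-cong m (λ j → ⋆-• (c j) f (G j) t) ⟩
  ∑≤ m (λ j → c j * (f ⋆ G j) t)                        ∎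
  where open ≡-Reasoning

-- The Euler operator θ = x d/dx

θ : Series → Series
θ f t = ℕ→ℚ t * f t

θ-cong : ∀ {f g} → f ≗ g → θ f ≗ θ g
θ-cong f≗g t = cong (ℕ→ℚ t *_) (f≗g t)

θ-one : ∀ t → θ one t ≡ 0ℚ
θ-one zero = refl
θ-one (suc t) = *-zeroʳ (ℕ→ℚ (suc t))

θ-⋆ : ∀ f g → θ (f ⋆ g) ≗ θ f ⋆ g ⊕ f ⋆ θ g
θ-⋆ f g t = begin
  ℕ→ℚ t * ∑≤ t (λ i → f i * g (t ∸ i))         ≡⟨ sym (∑≤-*ˡ t (ℕ→ℚ t) _) ⟩
  ∑≤ t (λ i → ℕ→ℚ t * (f i * g (t ∸ i)))       ≡⟨ ∑≤-cong≤ t split ⟩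
  ∑≤ t (λ i → θ f i * g (t ∸ i) + f i * θ g (t ∸ i)) ≡⟨ ∑≤-+ t _ _ ⟩
  (θ f ⋆ g ⊕ f ⋆ θ g) t                          ∎
  where
  open ≡-Reasoning
  split : ∀ i → i ≤ t → ℕ→ℚ t * (f i * g (t ∸ i)) ≡ θ f i * g (t ∸ i) + f i * θ g (t ∸ i)
  split i i≤t = begin
    ℕ→ℚ t * (f i * g (t ∸ i))                     ≡⟨ cong (λ s → ℕ→ℚ s * (f i * g (t ∸ i))) (sym (ℕP.m+[n∸m]≡n i≤t)) ⟩
    ℕ→ℚ (i ℕ.+ (t ∸ i)) * (f i * g (t ∸ i))       ≡⟨ cong (_* (f i * g (t ∸ i))) (ℕ→ℚ-+ i (t ∸ i)) ⟩
    (ℕ→ℚ i + ℕ→ℚ (t ∸ i)) * (f i * g (t ∸ i))     ≡⟨ solve 4 (λ a b c d → (a :+ b) :* (c :* d) := a :* c :* d :+ c :* (b :* d))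
                                                             refl (ℕ→ℚ i) (ℕ→ℚ (t ∸ i)) (f i) (g (t ∸ i)) ⟩
    θ f i * g (t ∸ i) + f i * θ g (t ∸ i)         ∎

X : Series
X (suc zero) = 1ℚ
X _ = 0ℚ

1-X : Series
1-X zero = 1ℚ
1-X (suc zero) = - 1ℚ
1-X (suc (suc _)) = 0ℚ

[1-X]^ : ℕ → Series
[1-X]^ zero = one
[1-X]^ (suc b) = 1-X ⋆ [1-X]^ b

X/[1-X] : Series
X/[1-X] zero = 0ℚ
X/[1-X] (suc _) = 1ℚ

1-X⋆-zero : ∀ g → (1-X ⋆ g) 0 ≡ g 0
1-X⋆-zero g = *-identityˡ (g 0)

1-X⋆-suc : ∀ g t → (1-X ⋆ g) (suc t) ≡ g (suc t) - g t
1-X⋆-suc g t = cong₂ _+_ (*-identityˡ (g (suc t))) (tail t)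
  where
  -1* : ∀ x → - 1ℚ * x ≡ - x
  -1* x = trans (sym (neg-distribˡ-* 1ℚ x)) (cong -_ (*-identityˡ x))
  tail : ∀ t → ∑≤ t (λ i → 1-X (suc i) * g (t ∸ i)) ≡ - g t
  tail zero = -1* (g 0)
  tail (suc t) = trans (cong₂ _+_ (-1* (g (suc t))) (∑≤-zero t _ (λ i _ → *-zeroˡ (g (t ∸ i))))) (+-identityʳ _)

X⋆-suc : ∀ g t → (X ⋆ g) (suc t) ≡ g t
X⋆-suc g t = trans (cong₂ _+_ (*-zeroˡ (g (suc t))) (tail t)) (+-identityˡ (g t))
  where
  tail : ∀ t → ∑≤ t (λ i → X (suc i) * g (t ∸ i)) ≡ g t
  tail zero = *-identityˡ (g 0)
  tail (suc t) = trans (cong₂ _+_ (*-identityˡ (g (suc t))) (∑≤-zero t _ (λ i _ → *-zeroˡ (g (t ∸ i))))) (+-identityʳ _)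

1-X⋆X/[1-X] : 1-X ⋆ X/[1-X] ≗ X
1-X⋆X/[1-X] zero = refl
1-X⋆X/[1-X] (suc zero) = refl
1-X⋆X/[1-X] (suc (suc t)) = trans (1-X⋆-suc X/[1-X] (suc t)) (+-inverseʳ 1ℚ)

θ-1-X : θ 1-X ≗ - 1ℚ • X
θ-1-X zero = refl
θ-1-X (suc zero) = refl
θ-1-X (suc (suc t)) = *-zeroʳ (ℕ→ℚ (suc (suc t)))

θ-[1-X]^ : ∀ b → 1-X ⋆ θ ([1-X]^ b) ≗ - ℕ→ℚ b • (X ⋆ [1-X]^ b)
θ-[1-X]^ zero t =
  trans (∑≤-zero t _ (λ i _ → trans (cong (1-X i *_) (θ-one (t ∸ i))) (*-zeroʳ (1-X i)))) (sym (*-zeroˡ ((X ⋆ one) t)))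
θ-[1-X]^ (suc b) t = begin
  (1-X ⋆ θ (1-X ⋆ B)) t                               ≡⟨ ⋆-congʳ 1-X (θ-⋆ 1-X B) t ⟩
  (1-X ⋆ (θ 1-X ⋆ B ⊕ 1-X ⋆ θ B)) t                  ≡⟨ ⋆-distribˡ-⊕ 1-X (θ 1-X ⋆ B) (1-X ⋆ θ B) t ⟩
  (1-X ⋆ (θ 1-X ⋆ B)) t + (1-X ⋆ (1-X ⋆ θ B)) t      ≡⟨ cong₂ _+_ (⋆-congʳ 1-X (⋆-congˡ B θ-1-X) t) (⋆-congʳ 1-X (θ-[1-X]^ b) t) ⟩
  (1-X ⋆ ((- 1ℚ • X) ⋆ B)) t + (1-X ⋆ (- b′ • (X ⋆ B))) t ≡⟨ cong₂ _+_ (⋆-congʳ 1-X (•-⋆ (- 1ℚ) X B) t) refl ⟩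
  (1-X ⋆ (- 1ℚ • (X ⋆ B))) t + (1-X ⋆ (- b′ • (X ⋆ B))) t ≡⟨ cong₂ _+_ (⋆-• (- 1ℚ) 1-X (X ⋆ B) t) (⋆-• (- b′) 1-X (X ⋆ B) t) ⟩
  - 1ℚ * Y + - b′ * Y                                 ≡⟨ solve 2 (λ y c → :- con 1ℚ :* y :+ :- c :* y := :- (con 1ℚ :+ c) :* y) refl Y b′ ⟩
  - (1ℚ + b′) * Y                                     ≡⟨ cong₂ (λ c y → - c * y) (sym (ℕ→ℚ-suc b)) (⋆-leftComm 1-X X B t) ⟩
  - ℕ→ℚ (suc b) * (X ⋆ [1-X]^ (suc b)) t             ∎
  where
  open ≡-Reasoning
  B = [1-X]^ b
  b′ = ℕ→ℚ b
  Y = (1-X ⋆ (X ⋆ B)) t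

[1-X]^-+ : ∀ a b → [1-X]^ (a ℕ.+ b) ≗ [1-X]^ a ⋆ [1-X]^ b
[1-X]^-+ zero b t = sym (⋆-identityˡ ([1-X]^ b) t)
[1-X]^-+ (suc a) b t =
  trans (⋆-congʳ 1-X ([1-X]^-+ a b) t) (sym (⋆-assoc 1-X ([1-X]^ a) ([1-X]^ b) t))

[1-X]^-zero : ∀ b → [1-X]^ b 0 ≡ 1ℚ
[1-X]^-zero zero = refl
[1-X]^-zero (suc b) = trans (1-X⋆-zero ([1-X]^ b)) ([1-X]^-zero b)

-- The coefficients of a series f with (1 - x) θ f = c x f obey (t + 1) f_{t+1} = (t + c) f_t.
recurrence-unique : ∀ c N (f g : Series) → f 0 ≡ g 0 →
  (∀ t → t < N → (1-X ⋆ θ f) (suc t) ≡ c * f t) →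
  (∀ t → t < N → (1-X ⋆ θ g) (suc t) ≡ c * g t) →
  ∀ t → t ≤ N → f t ≡ g t
recurrence-unique c N f g f₀≡g₀ rec-f rec-g zero _ = f₀≡g₀
recurrence-unique c N f g f₀≡g₀ rec-f rec-g (suc t) t<N = *-cancelˡ-ℕ→ℚ-suc t (begin
  ℕ→ℚ (suc t) * f (suc t)   ≡⟨ step f (rec-f t t<N) ⟩
  (ℕ→ℚ t + c) * f t         ≡⟨ cong ((ℕ→ℚ t + c) *_) (recurrence-unique c N f g f₀≡g₀ rec-f rec-g t (ℕP.<⇒≤ t<N)) ⟩
  (ℕ→ℚ t + c) * g t         ≡⟨ sym (step g (rec-g t t<N)) ⟩
  ℕ→ℚ (suc t) * g (suc t)   ∎)
  where
  open ≡-Reasoning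
  step : ∀ h → (1-X ⋆ θ h) (suc t) ≡ c * h t → ℕ→ℚ (suc t) * h (suc t) ≡ (ℕ→ℚ t + c) * h t
  step h eq = begin
    θ h (suc t)                          ≡⟨ solve 2 (λ x y → x := (x :- y) :+ y) refl (θ h (suc t)) (θ h t) ⟩
    (θ h (suc t) - θ h t) + θ h t        ≡⟨ cong (_+ θ h t) (trans (sym (1-X⋆-suc (θ h) t)) eq) ⟩
    c * h t + ℕ→ℚ t * h t                ≡⟨ solve 3 (λ a x y → a :* y :+ x :* y := (x :+ a) :* y) refl c (ℕ→ℚ t) (h t) ⟩
    (ℕ→ℚ t + c) * h t                    ∎

-- π b = ∑ₐ a^(b-1) xᵃ; in particular π 0 = ℓ = -log (1 - x), whose powers are ℓ^ j below.
π : ℕ → Series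
π b a = inv (ℕ→ℚ a) * ℕ→ℚ (a ℕ.^ b)

π-zero : ∀ b → π b 0 ≡ 0ℚ
π-zero b = *-zeroˡ (ℕ→ℚ (0 ℕ.^ b))

θ-π : ∀ b → θ (π b) ≗ π (suc b)
θ-π b a = begin
  ℕ→ℚ a * (inv (ℕ→ℚ a) * ℕ→ℚ (a ℕ.^ b))  ≡⟨ solve 3 (λ x y z → x :* (y :* z) := y :* (x :* z)) refl (ℕ→ℚ a) (inv (ℕ→ℚ a)) (ℕ→ℚ (a ℕ.^ b)) ⟩
  inv (ℕ→ℚ a) * (ℕ→ℚ a * ℕ→ℚ (a ℕ.^ b))  ≡⟨ cong (inv (ℕ→ℚ a) *_) (sym (ℕ→ℚ-* a (a ℕ.^ b))) ⟩
  π (suc b) a                             ∎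
  where open ≡-Reasoning

θ-π0 : θ (π 0) ≗ X/[1-X]
θ-π0 zero = refl
θ-π0 (suc a) = trans (sym (*-assoc (ℕ→ℚ (suc a)) _ 1ℚ)) (trans (*-identityʳ _) (ℕ→ℚ-*-inv (suc a)))

leading : List ℕ → Series
leading [] = π 0
leading (b ∷ _) = π b

-- πs k bs = π b₁ ⋆ ⋯ ⋆ π b_k, where bs is padded with zeros to length k.
πs : ℕ → List ℕ → Series
πs zero _ = one
πs (suc k) bs = leading bs ⋆ πs k (drop 1 bs)

ℓ^ : ℕ → Series
ℓ^ j = πs j []

ℓ^-below : ∀ j t → t < j → ℓ^ j t ≡ 0ℚ
ℓ^-below (suc j) t (s≤s t≤j) = ∑≤-zero t _ vanish
  where
  vanish : ∀ i → i ≤ t → π 0 i * ℓ^ j (t ∸ i) ≡ 0ℚ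
  vanish zero _ = *-zeroˡ (ℓ^ j t)
  vanish (suc i) i<t =
    trans (cong (π 0 (suc i) *_) (ℓ^-below j (t ∸ suc i) (ℕP.<-≤-trans (ℕP.∸-monoʳ-< (s≤s z≤n) i<t) t≤j)))
          (*-zeroʳ (π 0 (suc i)))

θ-ℓ^ : ∀ j → θ (ℓ^ (suc j)) ≗ ℕ→ℚ (suc j) • (X/[1-X] ⋆ ℓ^ j)
θ-ℓ^ j t = begin
  θ (π 0 ⋆ ℓ^ j) t                                   ≡⟨ θ-⋆ (π 0) (ℓ^ j) t ⟩
  (θ (π 0) ⋆ ℓ^ j) t + (π 0 ⋆ θ (ℓ^ j)) t          ≡⟨ cong₂ _+_ (⋆-congˡ (ℓ^ j) θ-π0 t) (lower j) ⟩
  (X/[1-X] ⋆ ℓ^ j) t + ℕ→ℚ j * (X/[1-X] ⋆ ℓ^ j) t  ≡⟨ solve 2 (λ y c → y :+ c :* y := (con 1ℚ :+ c) :* y) refl _ (ℕ→ℚ j) ⟩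
  (1ℚ + ℕ→ℚ j) * (X/[1-X] ⋆ ℓ^ j) t                  ≡⟨ cong (_* (X/[1-X] ⋆ ℓ^ j) t) (sym (ℕ→ℚ-suc j)) ⟩
  ℕ→ℚ (suc j) * (X/[1-X] ⋆ ℓ^ j) t                   ∎
  where
  open ≡-Reasoning
  lower : ∀ j → (π 0 ⋆ θ (ℓ^ j)) t ≡ ℕ→ℚ j * (X/[1-X] ⋆ ℓ^ j) t
  lower zero = trans (∑≤-zero t _ (λ i _ → trans (cong (π 0 i *_) (θ-one (t ∸ i))) (*-zeroʳ (π 0 i))))
                     (sym (*-zeroˡ ((X/[1-X] ⋆ one) t)))
  lower (suc j) = begin
    (π 0 ⋆ θ (ℓ^ (suc j))) t                         ≡⟨ ⋆-congʳ (π 0) (θ-ℓ^ j) t ⟩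
    (π 0 ⋆ (ℕ→ℚ (suc j) • (X/[1-X] ⋆ ℓ^ j))) t       ≡⟨ ⋆-• (ℕ→ℚ (suc j)) (π 0) (X/[1-X] ⋆ ℓ^ j) t ⟩
    ℕ→ℚ (suc j) * (π 0 ⋆ (X/[1-X] ⋆ ℓ^ j)) t         ≡⟨ cong (ℕ→ℚ (suc j) *_) (⋆-leftComm (π 0) X/[1-X] (ℓ^ j) t) ⟩
    ℕ→ℚ (suc j) * (X/[1-X] ⋆ ℓ^ (suc j)) t           ∎

-- Partial sums of (1 - x)ⁿ = exp (-n ℓ)

module TruncatedExp (n : ℕ) where

  expCoeff : ℕ → ℚ
  expCoeff j = sign j * ℕ→ℚ (n ℕ.^ j) * inv (ℕ→ℚ (j !))

  expTrunc : ℕ → Series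
  expTrunc N t = ∑≤ N (λ j → expCoeff j * ℓ^ j t)

  expCoeff-suc : ∀ j → expCoeff (suc j) * ℕ→ℚ (suc j) ≡ - ℕ→ℚ n * expCoeff j
  expCoeff-suc j = begin
    - s * ℕ→ℚ (n ℕ.* n ℕ.^ j) * inv (ℕ→ℚ (suc j ℕ.* j !)) * j+1
      ≡⟨ cong₂ (λ x y → - s * x * y * j+1) (ℕ→ℚ-* n (n ℕ.^ j)) (inv-ℕ→ℚ-* (suc j) (j !)) ⟩
    - s * (ℕ→ℚ n * nʲ) * (inv j+1 * j!⁻¹) * j+1
      ≡⟨ solve 6 (λ s a b x y z → :- s :* (a :* b) :* (x :* y) :* z := (:- a) :* (s :* b :* y) :* (z :* x))
                 refl s (ℕ→ℚ n) nʲ (inv j+1) j!⁻¹ j+1 ⟩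
    - ℕ→ℚ n * expCoeff j * (j+1 * inv j+1)
      ≡⟨ cong (- ℕ→ℚ n * expCoeff j *_) (ℕ→ℚ-*-inv (suc j)) ⟩
    - ℕ→ℚ n * expCoeff j * 1ℚ
      ≡⟨ *-identityʳ _ ⟩
    - ℕ→ℚ n * expCoeff j ∎
    where
    open ≡-Reasoning
    s = sign j
    nʲ = ℕ→ℚ (n ℕ.^ j)
    j!⁻¹ = inv (ℕ→ℚ (j !))
    j+1 = ℕ→ℚ (suc j)

  θ-expTrunc : ∀ N → θ (expTrunc (suc N)) ≗ - ℕ→ℚ n • (X/[1-X] ⋆ expTrunc N)
  θ-expTrunc N t = begin
    ℕ→ℚ t * expTrunc (suc N) t
      ≡⟨ sym (∑≤-*ˡ (suc N) (ℕ→ℚ t) (λ j → expCoeff j * ℓ^ j t)) ⟩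
    ∑≤ (suc N) (λ j → ℕ→ℚ t * (expCoeff j * ℓ^ j t))
      ≡⟨ ∑≤-cong (suc N) (λ j → solve 3 (λ a b c → a :* (b :* c) := b :* (a :* c)) refl (ℕ→ℚ t) (expCoeff j) (ℓ^ j t)) ⟩
    expCoeff 0 * θ one t + ∑≤ N (λ j → expCoeff (suc j) * θ (ℓ^ (suc j)) t)
      ≡⟨ cong₂ _+_ (trans (cong (expCoeff 0 *_) (θ-one t)) (*-zeroʳ (expCoeff 0))) (∑≤-cong N lower) ⟩
    0ℚ + ∑≤ N (λ j → - ℕ→ℚ n * (expCoeff j * (X/[1-X] ⋆ ℓ^ j) t))
      ≡⟨ trans (+-identityˡ _) (∑≤-*ˡ N (- ℕ→ℚ n) _) ⟩
    - ℕ→ℚ n * ∑≤ N (λ j → expCoeff j * (X/[1-X] ⋆ ℓ^ j) t)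
      ≡⟨ cong (- ℕ→ℚ n *_) (sym (⋆-∑≤ X/[1-X] N expCoeff ℓ^ t)) ⟩
    - ℕ→ℚ n * (X/[1-X] ⋆ expTrunc N) t ∎
    where
    open ≡-Reasoning
    lower : ∀ j → expCoeff (suc j) * θ (ℓ^ (suc j)) t ≡ - ℕ→ℚ n * (expCoeff j * (X/[1-X] ⋆ ℓ^ j) t)
    lower j = begin
      expCoeff (suc j) * θ (ℓ^ (suc j)) t                         ≡⟨ cong (expCoeff (suc j) *_) (θ-ℓ^ j t) ⟩
      expCoeff (suc j) * (ℕ→ℚ (suc j) * (X/[1-X] ⋆ ℓ^ j) t)       ≡⟨ sym (*-assoc (expCoeff (suc j)) _ _) ⟩
      expCoeff (suc j) * ℕ→ℚ (suc j) * (X/[1-X] ⋆ ℓ^ j) t         ≡⟨ cong (_* (X/[1-X] ⋆ ℓ^ j) t) (expCoeff-suc j) ⟩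
      - ℕ→ℚ n * expCoeff j * (X/[1-X] ⋆ ℓ^ j) t                   ≡⟨ *-assoc (- ℕ→ℚ n) (expCoeff j) _ ⟩
      - ℕ→ℚ n * (expCoeff j * (X/[1-X] ⋆ ℓ^ j) t)                 ∎

  expTrunc-suc : ∀ N t → t ≤ N → expTrunc (suc N) t ≡ expTrunc N t
  expTrunc-suc N t t≤N = begin
    expTrunc (suc N) t                                    ≡⟨ ∑≤-suc N (λ j → expCoeff j * ℓ^ j t) ⟩
    expTrunc N t + expCoeff (suc N) * ℓ^ (suc N) t      ≡⟨ cong (λ x → expTrunc N t + expCoeff (suc N) * x) (ℓ^-below (suc N) t (s≤s t≤N)) ⟩
    expTrunc N t + expCoeff (suc N) * 0ℚ                  ≡⟨ cong (expTrunc N t +_) (*-zeroʳ (expCoeff (suc N))) ⟩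
    expTrunc N t + 0ℚ                                     ≡⟨ +-identityʳ _ ⟩
    expTrunc N t                                          ∎
    where open ≡-Reasoning

  expTrunc-zero : ∀ N → expTrunc N 0 ≡ 1ℚ
  expTrunc-zero zero = refl
  expTrunc-zero (suc N) = cong (1ℚ +_) (∑≤-zero N _ (λ j _ → trans (cong (expCoeff (suc j) *_) (ℓ^-below (suc j) 0 (s≤s z≤n)))
                                                                  (*-zeroʳ (expCoeff (suc j)))))

  expTrunc≈[1-X]^ : ∀ N t → t ≤ N → expTrunc N t ≡ [1-X]^ n t
  expTrunc≈[1-X]^ zero zero _ = trans (expTrunc-zero 0) (sym ([1-X]^-zero n))
  expTrunc≈[1-X]^ (suc N) = recurrence-unique (- ℕ→ℚ n) (suc N) (expTrunc (suc N)) ([1-X]^ n)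
    (trans (expTrunc-zero (suc N)) (sym ([1-X]^-zero n))) rec-exp rec-pow
    where
    open ≡-Reasoning
    E = expTrunc N
    rec-exp : ∀ t → t < suc N → (1-X ⋆ θ (expTrunc (suc N))) (suc t) ≡ - ℕ→ℚ n * expTrunc (suc N) t
    rec-exp t (s≤s t≤N) = begin
      (1-X ⋆ θ (expTrunc (suc N))) (suc t)         ≡⟨ ⋆-congʳ 1-X (θ-expTrunc N) (suc t) ⟩
      (1-X ⋆ (- ℕ→ℚ n • (X/[1-X] ⋆ E))) (suc t)   ≡⟨ ⋆-• (- ℕ→ℚ n) 1-X (X/[1-X] ⋆ E) (suc t) ⟩
      - ℕ→ℚ n * (1-X ⋆ (X/[1-X] ⋆ E)) (suc t)     ≡⟨ cong (- ℕ→ℚ n *_) (sym (⋆-assoc 1-X X/[1-X] E (suc t))) ⟩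
      - ℕ→ℚ n * (1-X ⋆ X/[1-X] ⋆ E) (suc t)       ≡⟨ cong (- ℕ→ℚ n *_) (⋆-congˡ E 1-X⋆X/[1-X] (suc t)) ⟩
      - ℕ→ℚ n * (X ⋆ E) (suc t)                   ≡⟨ cong (- ℕ→ℚ n *_) (trans (X⋆-suc E t) (sym (expTrunc-suc N t t≤N))) ⟩
      - ℕ→ℚ n * expTrunc (suc N) t                ∎
    rec-pow : ∀ t → t < suc N → (1-X ⋆ θ ([1-X]^ n)) (suc t) ≡ - ℕ→ℚ n * [1-X]^ n t
    rec-pow t _ = trans (θ-[1-X]^ n (suc t)) (cong (- ℕ→ℚ n *_) (X⋆-suc ([1-X]^ n) t))

-- Eulerian polynomials

DegreeAtMost : ℕ → Series → Set
DegreeAtMost d f = ∀ t → d < t → f t ≡ 0ℚ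

one-degree : DegreeAtMost 0 one
one-degree (suc t) _ = refl

⋆-degree : ∀ {f g} d e → DegreeAtMost d f → DegreeAtMost e g → DegreeAtMost (d ℕ.+ e) (f ⋆ g)
⋆-degree {f} {g} d e deg-f deg-g t d+e<t = ∑≤-zero t _ vanish
  where
  vanish : ∀ i → i ≤ t → f i * g (t ∸ i) ≡ 0ℚ
  vanish i _ with i ℕP.≤? d
  ... | yes i≤d = trans (cong (f i *_) (deg-g (t ∸ i) e<t∸i)) (*-zeroʳ (f i))
    where
    e≤d+e∸i : e ≤ d ℕ.+ e ∸ i
    e≤d+e∸i = ℕP.≤-trans (ℕP.≤-reflexive (sym (ℕP.m+n∸m≡n d e))) (ℕP.∸-monoʳ-≤ (d ℕ.+ e) i≤d)
    e<t∸i : e < t ∸ i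
    e<t∸i = ℕP.≤-<-trans e≤d+e∸i (ℕP.∸-monoˡ-< d+e<t (ℕP.≤-trans i≤d (ℕP.m≤m+n d e)))
  ... | no i≰d = trans (cong (_* g (t ∸ i)) (deg-f i (ℕP.≰⇒> i≰d))) (*-zeroˡ (g (t ∸ i)))

⋆-top : ∀ {f g} d e → DegreeAtMost d f → DegreeAtMost e g → (f ⋆ g) (d ℕ.+ e) ≡ f d * g e
⋆-top {f} {g} d e deg-f deg-g =
  trans (∑≤-single (d ℕ.+ e) d _ (ℕP.m≤m+n d e) vanish) (cong (λ s → f d * g s) (ℕP.m+n∸m≡n d e))
  where
  vanish : ∀ i → i ≤ d ℕ.+ e → i ≢ d → f i * g (d ℕ.+ e ∸ i) ≡ 0ℚ
  vanish i _ i≢d with ℕP.<-cmp i d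
  ... | tri< i<d _ _ = trans (cong (f i *_) (deg-g _ e<d+e∸i)) (*-zeroʳ (f i))
    where
    e<d+e∸i : e < d ℕ.+ e ∸ i
    e<d+e∸i = ℕP.≤-<-trans (ℕP.≤-reflexive (sym (ℕP.m+n∸m≡n d e))) (ℕP.∸-monoʳ-< i<d (ℕP.m≤m+n d e))
  ... | tri≈ _ i≡d _ = ⊥-elim (i≢d i≡d)
  ... | tri> _ _ d<i = trans (cong (_* g (d ℕ.+ e ∸ i)) (deg-f i d<i)) (*-zeroˡ (g (d ℕ.+ e ∸ i)))

-- eulerian b = (1 - x)ᵇ ∑ₐ a^(b-1) xᵃ is x times the Eulerian polynomial A_{b-1}.
eulerian : ℕ → Series
eulerian b = π b ⋆ [1-X]^ b

eulerian-suc : ∀ b → eulerian (suc b) ≗ 1-X ⋆ θ (eulerian b) ⊕ ℕ→ℚ b • (X ⋆ eulerian b)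
eulerian-suc b t = sym (begin
  (1-X ⋆ θ (π b ⋆ B)) t + b′ * (X ⋆ eulerian b) t
    ≡⟨ cong (_+ b′ * (X ⋆ eulerian b) t) (trans (⋆-congʳ 1-X (θ-⋆ (π b) B) t) (⋆-distribˡ-⊕ 1-X (θ (π b) ⋆ B) (π b ⋆ θ B) t)) ⟩
  (1-X ⋆ (θ (π b) ⋆ B)) t + (1-X ⋆ (π b ⋆ θ B)) t + b′ * (X ⋆ eulerian b) t
    ≡⟨ cong₂ (λ u v → u + v + b′ * (X ⋆ eulerian b) t) raised lowered ⟩
  eulerian (suc b) t + - b′ * (X ⋆ eulerian b) t + b′ * (X ⋆ eulerian b) t
    ≡⟨ solve 3 (λ q c y → q :+ :- c :* y :+ c :* y := q) refl (eulerian (suc b) t) b′ ((X ⋆ eulerian b) t) ⟩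
  eulerian (suc b) t ∎)
  where
  open ≡-Reasoning
  B = [1-X]^ b
  b′ = ℕ→ℚ b
  raised : (1-X ⋆ (θ (π b) ⋆ B)) t ≡ eulerian (suc b) t
  raised = trans (⋆-leftComm 1-X (θ (π b)) B t) (⋆-congˡ ([1-X]^ (suc b)) (θ-π b) t)
  lowered : (1-X ⋆ (π b ⋆ θ B)) t ≡ - b′ * (X ⋆ eulerian b) t
  lowered = begin
    (1-X ⋆ (π b ⋆ θ B)) t             ≡⟨ ⋆-leftComm 1-X (π b) (θ B) t ⟩
    (π b ⋆ (1-X ⋆ θ B)) t             ≡⟨ ⋆-congʳ (π b) (θ-[1-X]^ b) t ⟩
    (π b ⋆ (- b′ • (X ⋆ B))) t        ≡⟨ ⋆-• (- b′) (π b) (X ⋆ B) t ⟩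
    - b′ * (π b ⋆ (X ⋆ B)) t          ≡⟨ cong (- b′ *_) (⋆-leftComm (π b) X B t) ⟩
    - b′ * (X ⋆ eulerian b) t         ∎

eulerian-suc-coeff : ∀ b t → eulerian (suc b) (suc t) ≡
  θ (eulerian b) (suc t) - θ (eulerian b) t + ℕ→ℚ b * eulerian b t
eulerian-suc-coeff b t = trans (eulerian-suc b (suc t))
  (cong₂ (λ u v → u + ℕ→ℚ b * v) (1-X⋆-suc (θ (eulerian b)) t) (X⋆-suc (eulerian b) t))

eulerian-degree : ∀ b → DegreeAtMost (suc b) (eulerian (suc b)) × eulerian (suc b) (suc b) ≡ δ (suc b) 1
eulerian-degree zero = degree , refl
  where
  θ-eulerian0 : ∀ s → θ (eulerian 0) (suc s) ≡ 1ℚ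
  θ-eulerian0 s = trans (θ-cong (⋆-identityʳ (π 0)) (suc s)) (θ-π0 (suc s))
  degree : DegreeAtMost 1 (eulerian 1)
  degree (suc zero) (s≤s ())
  degree (suc (suc t)) _ = begin
    eulerian 1 (suc (suc t))                                                     ≡⟨ eulerian-suc-coeff 0 (suc t) ⟩
    θ (eulerian 0) (suc (suc t)) - θ (eulerian 0) (suc t) + 0ℚ * eulerian 0 (suc t) ≡⟨ cong₂ (λ u v → u - v + 0ℚ * eulerian 0 (suc t))
                                                                                         (θ-eulerian0 (suc t)) (θ-eulerian0 t) ⟩
    1ℚ - 1ℚ + 0ℚ * eulerian 0 (suc t)                                            ≡⟨ cong (1ℚ - 1ℚ +_) (*-zeroˡ (eulerian 0 (suc t))) ⟩
    0ℚ                                                                           ∎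
    where open ≡-Reasoning
eulerian-degree (suc b) = degree , top
  where
  open ≡-Reasoning
  Q = eulerian (suc b)
  deg-Q = proj₁ (eulerian-degree b)
  degree : DegreeAtMost (suc (suc b)) (eulerian (suc (suc b)))
  degree (suc t) (s≤s b+1<t) = begin
    eulerian (suc (suc b)) (suc t)                     ≡⟨ eulerian-suc-coeff (suc b) t ⟩
    θ Q (suc t) - θ Q t + ℕ→ℚ (suc b) * Q t           ≡⟨ cong₂ (λ u v → ℕ→ℚ (suc t) * u - ℕ→ℚ t * v + ℕ→ℚ (suc b) * v)
                                                               (deg-Q (suc t) (ℕP.m<n⇒m<1+n b+1<t)) (deg-Q t b+1<t) ⟩
    ℕ→ℚ (suc t) * 0ℚ - ℕ→ℚ t * 0ℚ + ℕ→ℚ (suc b) * 0ℚ  ≡⟨ solve 3 (λ x y z → x :* con 0ℚ :- y :* con 0ℚ :+ z :* con 0ℚ := con 0ℚ)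
                                                                refl (ℕ→ℚ (suc t)) (ℕ→ℚ t) (ℕ→ℚ (suc b)) ⟩
    0ℚ                                                 ∎
  top : eulerian (suc (suc b)) (suc (suc b)) ≡ 0ℚ
  top = begin
    eulerian (suc (suc b)) (suc (suc b))                ≡⟨ eulerian-suc-coeff (suc b) (suc b) ⟩
    θ Q (suc (suc b)) - θ Q (suc b) + ℕ→ℚ (suc b) * Q (suc b)
      ≡⟨ cong (λ u → ℕ→ℚ (suc (suc b)) * u - θ Q (suc b) + ℕ→ℚ (suc b) * Q (suc b)) (deg-Q (suc (suc b)) ℕP.≤-refl) ⟩
    ℕ→ℚ (suc (suc b)) * 0ℚ - θ Q (suc b) + θ Q (suc b) ≡⟨ solve 2 (λ x y → x :* con 0ℚ :- y :+ y := con 0ℚ) refl (ℕ→ℚ (suc (suc b))) (θ Q (suc b)) ⟩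
    0ℚ                                                  ∎

π⋆ : List ℕ → Series → Series
π⋆ [] g = g
π⋆ (b ∷ bs) g = π b ⋆ π⋆ bs g

eulerian⋆ : List ℕ → Series
eulerian⋆ [] = one
eulerian⋆ (b ∷ bs) = eulerian b ⋆ eulerian⋆ bs

topCoeffs : List ℕ → ℚ
topCoeffs [] = 1ℚ
topCoeffs (b ∷ bs) = δ b 1 * topCoeffs bs

π⋆-cong : ∀ bs {g g′} → g ≗ g′ → π⋆ bs g ≗ π⋆ bs g′
π⋆-cong [] g≗g′ = g≗g′
π⋆-cong (b ∷ bs) g≗g′ = ⋆-congʳ (π b) (π⋆-cong bs g≗g′)

πs-+ : ∀ bs j → πs (length bs ℕ.+ j) bs ≗ π⋆ bs (ℓ^ j)
πs-+ [] j t = refl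
πs-+ (b ∷ bs) j = ⋆-congʳ (π b) (πs-+ bs j)

π⋆-∑≤ : ∀ bs m (c : ℕ → ℚ) (G : ℕ → Series) →
  π⋆ bs (λ s → ∑≤ m (λ j → c j * G j s)) ≗ λ t → ∑≤ m (λ j → c j * π⋆ bs (G j) t)
π⋆-∑≤ [] m c G t = refl
π⋆-∑≤ (b ∷ bs) m c G t =
  trans (⋆-congʳ (π b) (π⋆-∑≤ bs m c G) t) (⋆-∑≤ (π b) m c (λ j → π⋆ bs (G j)) t)

π⋆-[1-X]^ : ∀ bs h → π⋆ bs ([1-X]^ (sum bs) ⋆ h) ≗ eulerian⋆ bs ⋆ h
π⋆-[1-X]^ [] h t = refl
π⋆-[1-X]^ (b ∷ bs) h t = begin
  (π b ⋆ π⋆ bs ([1-X]^ (b ℕ.+ sum bs) ⋆ h)) t         ≡⟨ ⋆-congʳ (π b) (π⋆-cong bs split) t ⟩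
  (π b ⋆ π⋆ bs ([1-X]^ (sum bs) ⋆ ([1-X]^ b ⋆ h))) t  ≡⟨ ⋆-congʳ (π b) (π⋆-[1-X]^ bs ([1-X]^ b ⋆ h)) t ⟩
  (π b ⋆ (eulerian⋆ bs ⋆ ([1-X]^ b ⋆ h))) t           ≡⟨ ⋆-congʳ (π b) (⋆-leftComm (eulerian⋆ bs) ([1-X]^ b) h) t ⟩
  (π b ⋆ ([1-X]^ b ⋆ (eulerian⋆ bs ⋆ h))) t           ≡⟨ sym (⋆-assoc (π b) ([1-X]^ b) (eulerian⋆ bs ⋆ h) t) ⟩
  (eulerian b ⋆ (eulerian⋆ bs ⋆ h)) t                  ≡⟨ sym (⋆-assoc (eulerian b) (eulerian⋆ bs) h t) ⟩
  (eulerian⋆ (b ∷ bs) ⋆ h) t                          ∎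
  where
  open ≡-Reasoning
  split : [1-X]^ (b ℕ.+ sum bs) ⋆ h ≗ [1-X]^ (sum bs) ⋆ ([1-X]^ b ⋆ h)
  split s = begin
    ([1-X]^ (b ℕ.+ sum bs) ⋆ h) s            ≡⟨ ⋆-congˡ h ([1-X]^-+ b (sum bs)) s ⟩
    ([1-X]^ b ⋆ [1-X]^ (sum bs) ⋆ h) s       ≡⟨ ⋆-congˡ h (⋆-comm ([1-X]^ b) ([1-X]^ (sum bs))) s ⟩
    ([1-X]^ (sum bs) ⋆ [1-X]^ b ⋆ h) s       ≡⟨ ⋆-assoc ([1-X]^ (sum bs)) ([1-X]^ b) h s ⟩
    ([1-X]^ (sum bs) ⋆ ([1-X]^ b ⋆ h)) s     ∎

eulerian⋆-degree : ∀ {bs} → All (1 ≤_) bs →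
  DegreeAtMost (sum bs) (eulerian⋆ bs) × eulerian⋆ bs (sum bs) ≡ topCoeffs bs
eulerian⋆-degree [] = one-degree , refl
eulerian⋆-degree {suc b ∷ bs} (_ ∷ bs≥1) =
  ⋆-degree (suc b) (sum bs) deg-Q deg-Q⋆ ,
  trans (⋆-top (suc b) (sum bs) deg-Q deg-Q⋆) (cong₂ _*_ (proj₂ (eulerian-degree b)) (proj₂ (eulerian⋆-degree bs≥1)))
  where
  deg-Q = proj₁ (eulerian-degree b)
  deg-Q⋆ = proj₁ (eulerian⋆-degree bs≥1)

AgreeUpTo : ℕ → Series → Series → Set
AgreeUpTo N g g′ = ∀ t → t ≤ N → g t ≡ g′ t

⋆-agree : ∀ f {g g′} N → f 0 ≡ 0ℚ → AgreeUpTo N g g′ → AgreeUpTo (suc N) (f ⋆ g) (f ⋆ g′)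
⋆-agree f {g} {g′} N f₀≡0 g≈g′ = agree
  where
  f₀*≡0 : ∀ h s → f 0 * h s ≡ 0ℚ
  f₀*≡0 h s = trans (cong (_* h s) f₀≡0) (*-zeroˡ (h s))
  agree : AgreeUpTo (suc N) (f ⋆ g) (f ⋆ g′)
  agree zero _ = trans (f₀*≡0 g 0) (sym (f₀*≡0 g′ 0))
  agree (suc t) (s≤s t≤N) = cong₂ _+_ (trans (f₀*≡0 g (suc t)) (sym (f₀*≡0 g′ (suc t))))
    (∑≤-cong t (λ i → cong (f (suc i) *_) (g≈g′ (t ∸ i) (ℕP.≤-trans (ℕP.m∸n≤m t i) t≤N))))

π⋆-agree : ∀ bs {g g′} N → AgreeUpTo N g g′ → AgreeUpTo (length bs ℕ.+ N) (π⋆ bs g) (π⋆ bs g′)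
π⋆-agree [] N g≈g′ = g≈g′
π⋆-agree (b ∷ bs) N g≈g′ = ⋆-agree (π b) (length bs ℕ.+ N) (π-zero b) (π⋆-agree bs N g≈g′)

-- Sums over compositions

sumℚ-map-++ : ∀ {A : Set} (F : A → ℚ) xs ys → sumℚ (map F (xs ++ ys)) ≡ sumℚ (map F xs) + sumℚ (map F ys)
sumℚ-map-++ F [] ys = sym (+-identityˡ _)
sumℚ-map-++ F (x ∷ xs) ys = trans (cong (F x +_) (sumℚ-map-++ F xs ys)) (sym (+-assoc (F x) _ _))

sumℚ-concatMap : ∀ {A B : Set} (F : B → ℚ) (g : A → List B) xs →
  sumℚ (map F (concatMap g xs)) ≡ sumℚ (map (λ x → sumℚ (map F (g x))) xs)
sumℚ-concatMap F g [] = refl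
sumℚ-concatMap F g (x ∷ xs) = trans (sumℚ-map-++ F (g x) (concatMap g xs)) (cong (sumℚ (map F (g x)) +_) (sumℚ-concatMap F g xs))

sumℚ-map-*ˡ : ∀ {A : Set} c (F : A → ℚ) xs → sumℚ (map (λ x → c * F x) xs) ≡ c * sumℚ (map F xs)
sumℚ-map-*ˡ c F [] = sym (*-zeroʳ c)
sumℚ-map-*ˡ c F (x ∷ xs) = trans (cong (c * F x +_) (sumℚ-map-*ˡ c F xs)) (sym (*-distribˡ-+ c (F x) _))

sumℚ-applyUpTo : ∀ t (h : ℕ → ℕ) (G : ℕ → ℚ) → sumℚ (map G (applyUpTo h (suc t))) ≡ ∑≤ t (G ∘ h)
sumℚ-applyUpTo zero h G = +-identityʳ (G (h 0))
sumℚ-applyUpTo (suc t) h G = cong (G (h 0) +_) (sumℚ-applyUpTo t (h ∘ suc) G)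

sumℚ-oneTo : ∀ (f g : Series) n → f 0 ≡ 0ℚ → sumℚ (map (λ a → f a * g (n ∸ a)) (oneTo n)) ≡ (f ⋆ g) n
sumℚ-oneTo f g zero f₀≡0 = sym (trans (cong (_* g 0) f₀≡0) (*-zeroˡ (g 0)))
sumℚ-oneTo f g (suc t) f₀≡0 = begin
  sumℚ (map F (map suc (upTo (suc t))))   ≡⟨ cong sumℚ (sym (map-∘ {g = F} {f = suc} (upTo (suc t)))) ⟩
  sumℚ (map (F ∘ suc) (upTo (suc t)))     ≡⟨ sumℚ-applyUpTo t (λ i → i) (F ∘ suc) ⟩
  ∑≤ t (F ∘ suc)                          ≡⟨ sym (+-identityˡ _) ⟩
  0ℚ + ∑≤ t (F ∘ suc)                     ≡⟨ cong (_+ ∑≤ t (F ∘ suc)) (sym (trans (cong (_* g (suc t)) f₀≡0) (*-zeroˡ (g (suc t))))) ⟩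
  (f ⋆ g) (suc t)                         ∎
  where
  open ≡-Reasoning
  F = λ a → f a * g (suc t ∸ a)

weight : List ℕ → List ℕ → ℚ
weight bs as = inv (ℕ→ℚ (product as)) * ℕ→ℚ (powProd as bs)

weight-∷ : ∀ bs a as → weight bs (a ∷ as) ≡ leading bs a * weight (drop 1 bs) as
weight-∷ [] a as = begin
  inv (ℕ→ℚ (a ℕ.* product as)) * 1ℚ                      ≡⟨ cong (_* 1ℚ) (inv-ℕ→ℚ-* a (product as)) ⟩
  inv (ℕ→ℚ a) * inv (ℕ→ℚ (product as)) * 1ℚ              ≡⟨ solve 2 (λ x y → x :* y :* con 1ℚ := x :* con 1ℚ :* (y :* con 1ℚ)) refl (inv (ℕ→ℚ a)) (inv (ℕ→ℚ (product as))) ⟩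
  inv (ℕ→ℚ a) * 1ℚ * (inv (ℕ→ℚ (product as)) * 1ℚ)       ≡⟨ cong (λ p → π 0 a * (inv (ℕ→ℚ (product as)) * ℕ→ℚ p)) (sym (powProd-[] as)) ⟩
  π 0 a * weight [] as                                    ∎
  where
  open ≡-Reasoning
  powProd-[] : ∀ as → powProd as [] ≡ 1
  powProd-[] [] = refl
  powProd-[] (_ ∷ _) = refl
weight-∷ (b ∷ bs) a as = begin
  inv (ℕ→ℚ (a ℕ.* product as)) * ℕ→ℚ (a ℕ.^ b ℕ.* powProd as bs)
    ≡⟨ cong₂ _*_ (inv-ℕ→ℚ-* a (product as)) (ℕ→ℚ-* (a ℕ.^ b) (powProd as bs)) ⟩
  inv (ℕ→ℚ a) * inv (ℕ→ℚ (product as)) * (ℕ→ℚ (a ℕ.^ b) * ℕ→ℚ (powProd as bs))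
    ≡⟨ solve 4 (λ x y z w → x :* y :* (z :* w) := x :* z :* (y :* w)) refl (inv (ℕ→ℚ a)) (inv (ℕ→ℚ (product as))) (ℕ→ℚ (a ℕ.^ b)) (ℕ→ℚ (powProd as bs)) ⟩
  π b a * weight bs as ∎
  where open ≡-Reasoning

compositions-weight : ∀ k bs n → sumℚ (map (weight bs) (compositions k n)) ≡ πs k bs n
compositions-weight zero bs zero = refl
compositions-weight zero bs (suc n) = refl
compositions-weight (suc k) bs n = begin
  sumℚ (map (weight bs) (concatMap (λ a → map (a ∷_) (compositions k (n ∸ a))) (oneTo n)))
    ≡⟨ sumℚ-concatMap (weight bs) (λ a → map (a ∷_) (compositions k (n ∸ a))) (oneTo n) ⟩
  sumℚ (map (λ a → sumℚ (map (weight bs) (map (a ∷_) (compositions k (n ∸ a))))) (oneTo n))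
    ≡⟨ cong sumℚ (map-cong fixed-first-part (oneTo n)) ⟩
  sumℚ (map (λ a → leading bs a * πs k (drop 1 bs) (n ∸ a)) (oneTo n))
    ≡⟨ sumℚ-oneTo (leading bs) (πs k (drop 1 bs)) n (leading-zero bs) ⟩
  πs (suc k) bs n ∎
  where
  open ≡-Reasoning
  leading-zero : ∀ bs → leading bs 0 ≡ 0ℚ
  leading-zero [] = π-zero 0
  leading-zero (b ∷ _) = π-zero b
  fixed-first-part : ∀ a → sumℚ (map (weight bs) (map (a ∷_) (compositions k (n ∸ a)))) ≡ leading bs a * πs k (drop 1 bs) (n ∸ a)
  fixed-first-part a = begin
    sumℚ (map (weight bs) (map (a ∷_) (compositions k (n ∸ a))))               ≡⟨ cong sumℚ (sym (map-∘ {g = weight bs} {f = a ∷_} (compositions k (n ∸ a)))) ⟩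
    sumℚ (map (weight bs ∘ (a ∷_)) (compositions k (n ∸ a)))                   ≡⟨ cong sumℚ (map-cong (weight-∷ bs a) (compositions k (n ∸ a))) ⟩
    sumℚ (map (λ as → leading bs a * weight (drop 1 bs) as) (compositions k (n ∸ a))) ≡⟨ sumℚ-map-*ˡ (leading bs a) _ (compositions k (n ∸ a)) ⟩
    leading bs a * sumℚ (map (weight (drop 1 bs)) (compositions k (n ∸ a)))    ≡⟨ cong (leading bs a *_) (compositions-weight k (drop 1 bs) (n ∸ a)) ⟩
    leading bs a * πs k (drop 1 bs) (n ∸ a)                                     ∎

-- The coefficient of the summand with k = r + j, in terms of m = n - r.
termCoeff : ℕ → ℕ → ℕ → ℚ
termCoeff n m j = sign (m ∸ j) * ℕ→ℚ ((m ∸ j) !) * inv (ℕ→ℚ (n ! ℕ.* (n ℕ.^ (m ∸ j)))) * ℕ→ℚ (m C j)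

term≡termCoeff*weight : ∀ n r j bs as → term n r (r ℕ.+ j) bs as ≡ termCoeff n (n ∸ r) j * weight bs as
term≡termCoeff*weight n r j bs as = begin
  sign d * ℕ→ℚ (d !) * inv (ℕ→ℚ (n ! ℕ.* (n ℕ.^ d) ℕ.* product as)) * ℕ→ℚ ((n ∸ r) C i) * p
    ≡⟨ cong₂ (λ d i → sign d * ℕ→ℚ (d !) * inv (ℕ→ℚ (n ! ℕ.* (n ℕ.^ d) ℕ.* product as)) * ℕ→ℚ (m C i) * p)
             (sym (ℕP.∸-+-assoc n r j)) (ℕP.m+n∸m≡n r j) ⟩
  s * f * inv (ℕ→ℚ (A ℕ.* product as)) * c * p       ≡⟨ cong (λ x → s * f * x * c * p) (inv-ℕ→ℚ-* A (product as)) ⟩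
  s * f * (inv (ℕ→ℚ A) * inv (ℕ→ℚ (product as))) * c * p
    ≡⟨ solve 6 (λ a b x y z w → a :* b :* (x :* y) :* z :* w := a :* b :* x :* z :* (y :* w))
               refl s f (inv (ℕ→ℚ A)) (inv (ℕ→ℚ (product as))) c p ⟩
  termCoeff n m j * weight bs as                      ∎
  where
  open ≡-Reasoning
  m = n ∸ r
  d = n ∸ (r ℕ.+ j)
  i = r ℕ.+ j ∸ r
  s = sign (m ∸ j)
  f = ℕ→ℚ ((m ∸ j) !)
  A = n ! ℕ.* (n ℕ.^ (m ∸ j))
  c = ℕ→ℚ (m C j)
  p = ℕ→ℚ (powProd as bs)

prefactor : ℕ → ℕ → ℚ
prefactor n m = sign m * ℕ→ℚ (m !) * inv (ℕ→ℚ (n ! ℕ.* (n ℕ.^ m)))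

m!≡mCj*j!*[m∸j]! : ∀ m j → j ≤ m → m ! ≡ (m C j) ℕ.* (j ! ℕ.* (m ∸ j) !)
m!≡mCj*j!*[m∸j]! m j j≤m = sym (trans (cong (ℕ._* (j ! ℕ.* (m ∸ j) !)) (nCk≡n!/k![n-k]! j≤m))
  (m/n*n≡m {{ℕP.m*n≢0 (j !) ((m ∸ j) !) {{ℕP._!≢0 j}} {{ℕP._!≢0 (m ∸ j)}}}} (k![n∸k]!∣n! j≤m)))

termCoeff-split : ∀ n m j .{{_ : ℕ.NonZero n}} → j ≤ m → termCoeff n m j ≡ prefactor n m * TruncatedExp.expCoeff n j
termCoeff-split n m j j≤m = sym (begin
  sign m * ℕ→ℚ (m !) * inv (ℕ→ℚ (n ! ℕ.* (n ℕ.^ m))) * (sʲ * nʲ * j!⁻¹)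
    ≡⟨ cong₂ (λ u v → u * v * inv (ℕ→ℚ (n ! ℕ.* (n ℕ.^ m))) * (sʲ * nʲ * j!⁻¹)) sign-split fact-split ⟩
  sʲ * sᵈ * (mCj * (j! * d!)) * inv (ℕ→ℚ (n ! ℕ.* (n ℕ.^ m))) * (sʲ * nʲ * j!⁻¹)
    ≡⟨ cong (λ u → sʲ * sᵈ * (mCj * (j! * d!)) * u * (sʲ * nʲ * j!⁻¹)) inv-split ⟩
  sʲ * sᵈ * (mCj * (j! * d!)) * (n!⁻¹ * (nʲ⁻¹ * nᵈ⁻¹)) * (sʲ * nʲ * j!⁻¹)
    ≡⟨ solve 10 (λ a b c x y z u v w o → a :* b :* (c :* (x :* y)) :* (z :* (u :* v)) :* (a :* w :* o)
                   := a :* a :* (w :* u) :* (x :* o) :* (b :* y :* (z :* v) :* c))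
                refl sʲ sᵈ mCj j! d! n!⁻¹ nʲ⁻¹ nᵈ⁻¹ nʲ j!⁻¹ ⟩
  sʲ * sʲ * (nʲ * nʲ⁻¹) * (j! * j!⁻¹) * (sᵈ * d! * (n!⁻¹ * nᵈ⁻¹) * mCj)
    ≡⟨ cong₂ (λ u v → u * v * (j! * j!⁻¹) * (sᵈ * d! * (n!⁻¹ * nᵈ⁻¹) * mCj))
             (sign-*-sign j) (ℕ→ℚ-*-inv (n ℕ.^ j) {{ℕP.m^n≢0 n j}}) ⟩
  1ℚ * 1ℚ * (j! * j!⁻¹) * (sᵈ * d! * (n!⁻¹ * nᵈ⁻¹) * mCj)
    ≡⟨ cong (λ u → 1ℚ * 1ℚ * u * (sᵈ * d! * (n!⁻¹ * nᵈ⁻¹) * mCj)) (ℕ→ℚ-*-inv (j !) {{ℕP._!≢0 j}}) ⟩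
  1ℚ * 1ℚ * 1ℚ * (sᵈ * d! * (n!⁻¹ * nᵈ⁻¹) * mCj)
    ≡⟨ *-identityˡ _ ⟩
  sᵈ * d! * (n!⁻¹ * nᵈ⁻¹) * mCj
    ≡⟨ cong (λ u → sᵈ * d! * u * mCj) (sym (inv-ℕ→ℚ-* (n !) (n ℕ.^ d))) ⟩
  sᵈ * d! * inv (ℕ→ℚ (n ! ℕ.* (n ℕ.^ d))) * mCj ∎)
  where
  open ≡-Reasoning
  d = m ∸ j
  j+d≡m : j ℕ.+ d ≡ m
  j+d≡m = ℕP.m+[n∸m]≡n j≤m
  sʲ = sign j
  sᵈ = sign d
  mCj = ℕ→ℚ (m C j)
  j! = ℕ→ℚ (j !)
  d! = ℕ→ℚ (d !)
  nʲ = ℕ→ℚ (n ℕ.^ j)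
  n!⁻¹ = inv (ℕ→ℚ (n !))
  nʲ⁻¹ = inv nʲ
  nᵈ⁻¹ = inv (ℕ→ℚ (n ℕ.^ d))
  j!⁻¹ = inv j!
  sign-split : sign m ≡ sʲ * sᵈ
  sign-split = trans (cong sign (sym j+d≡m)) (sign-+ j d)
  fact-split : ℕ→ℚ (m !) ≡ mCj * (j! * d!)
  fact-split = trans (cong ℕ→ℚ (m!≡mCj*j!*[m∸j]! m j j≤m)) (trans (ℕ→ℚ-* (m C j) _) (cong (mCj *_) (ℕ→ℚ-* (j !) (d !))))
  inv-split : inv (ℕ→ℚ (n ! ℕ.* (n ℕ.^ m))) ≡ n!⁻¹ * (nʲ⁻¹ * nᵈ⁻¹)
  inv-split = begin
    inv (ℕ→ℚ (n ! ℕ.* (n ℕ.^ m)))               ≡⟨ inv-ℕ→ℚ-* (n !) (n ℕ.^ m) ⟩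
    n!⁻¹ * inv (ℕ→ℚ (n ℕ.^ m))                  ≡⟨ cong (λ e → n!⁻¹ * inv (ℕ→ℚ (n ℕ.^ e))) (sym j+d≡m) ⟩
    n!⁻¹ * inv (ℕ→ℚ (n ℕ.^ (j ℕ.+ d)))          ≡⟨ cong (λ x → n!⁻¹ * inv (ℕ→ℚ x)) (ℕP.^-distribˡ-+-* n j d) ⟩
    n!⁻¹ * inv (ℕ→ℚ (n ℕ.^ j ℕ.* n ℕ.^ d))      ≡⟨ cong (n!⁻¹ *_) (inv-ℕ→ℚ-* (n ℕ.^ j) (n ℕ.^ d)) ⟩
    n!⁻¹ * (nʲ⁻¹ * nᵈ⁻¹)                        ∎

prefactor-zero : ∀ n → prefactor n 0 ≡ inv (ℕ→ℚ (n !))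
prefactor-zero n = trans (*-identityˡ _) (cong (inv ∘ ℕ→ℚ) (ℕP.*-identityʳ (n !)))

kSum : ℕ → ℕ → List ℕ → ℚ
kSum n r bs = sumℚ (map (λ k → sumℚ (map (term n r k bs) (compositions k n))) (map (r ℕ.+_) (upTo (suc (n ∸ r)))))

length≤sum : ∀ {bs} → All (1 ≤_) bs → length bs ≤ sum bs
length≤sum [] = z≤n
length≤sum (b≥1 ∷ bs≥1) = ℕP.+-mono-≤ b≥1 (length≤sum bs≥1)

kSum≡prefactor*topCoeffs : ∀ n bs .{{_ : ℕ.NonZero n}} → All (1 ≤_) bs → sum bs ≡ n →
  kSum n (length bs) bs ≡ prefactor n (n ∸ length bs) * topCoeffs bs
kSum≡prefactor*topCoeffs n bs bs≥1 Σbs≡n = begin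
  kSum n r bs                                     ≡⟨ cong sumℚ (sym (map-∘ {g = G} {f = r ℕ.+_} (upTo (suc m)))) ⟩
  sumℚ (map (G ∘ (r ℕ.+_)) (upTo (suc m)))        ≡⟨ sumℚ-applyUpTo m (λ i → i) (G ∘ (r ℕ.+_)) ⟩
  ∑≤ m (λ j → G (r ℕ.+ j))                        ≡⟨ ∑≤-cong≤ m summand ⟩
  ∑≤ m (λ j → κ * (expCoeff j * π⋆ bs (ℓ^ j) n)) ≡⟨ ∑≤-*ˡ m κ _ ⟩
  κ * ∑≤ m (λ j → expCoeff j * π⋆ bs (ℓ^ j) n)  ≡⟨ cong (κ *_) (sym (π⋆-∑≤ bs m expCoeff ℓ^ n)) ⟩
  κ * π⋆ bs (expTrunc m) n                        ≡⟨ cong (κ *_) (π⋆-agree bs m (expTrunc≈[1-X]^ m) n (ℕP.≤-reflexive (sym r+m≡n))) ⟩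
  κ * π⋆ bs ([1-X]^ n) n                          ≡⟨ cong (λ s → κ * π⋆ bs ([1-X]^ s) n) (sym Σbs≡n) ⟩
  κ * π⋆ bs ([1-X]^ (sum bs)) n                   ≡⟨ cong (κ *_) (π⋆-[1-X]^-sum n) ⟩
  κ * eulerian⋆ bs n                              ≡⟨ cong (λ s → κ * eulerian⋆ bs s) (sym Σbs≡n) ⟩
  κ * eulerian⋆ bs (sum bs)                       ≡⟨ cong (κ *_) (proj₂ (eulerian⋆-degree bs≥1)) ⟩
  κ * topCoeffs bs                                ∎
  where
  open ≡-Reasoning
  open TruncatedExp n
  r = length bs
  m = n ∸ r
  κ = prefactor n m
  r+m≡n : r ℕ.+ m ≡ n
  r+m≡n = ℕP.m+[n∸m]≡n (ℕP.≤-trans (length≤sum bs≥1) (ℕP.≤-reflexive Σbs≡n))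
  G : ℕ → ℚ
  G k = sumℚ (map (term n r k bs) (compositions k n))
  π⋆-[1-X]^-sum : π⋆ bs ([1-X]^ (sum bs)) ≗ eulerian⋆ bs
  π⋆-[1-X]^-sum t = begin
    π⋆ bs ([1-X]^ (sum bs)) t           ≡⟨ π⋆-cong bs (λ s → sym (⋆-identityʳ ([1-X]^ (sum bs)) s)) t ⟩
    π⋆ bs ([1-X]^ (sum bs) ⋆ one) t     ≡⟨ π⋆-[1-X]^ bs one t ⟩
    (eulerian⋆ bs ⋆ one) t              ≡⟨ ⋆-identityʳ (eulerian⋆ bs) t ⟩
    eulerian⋆ bs t                      ∎
  summand : ∀ j → j ≤ m → G (r ℕ.+ j) ≡ κ * (expCoeff j * π⋆ bs (ℓ^ j) n)
  summand j j≤m = begin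
    G (r ℕ.+ j)                                                  ≡⟨ cong sumℚ (map-cong (term≡termCoeff*weight n r j bs) comps) ⟩
    sumℚ (map (λ as → termCoeff n m j * weight bs as) comps)     ≡⟨ sumℚ-map-*ˡ (termCoeff n m j) (weight bs) comps ⟩
    termCoeff n m j * sumℚ (map (weight bs) comps)               ≡⟨ cong (termCoeff n m j *_) (compositions-weight (r ℕ.+ j) bs n) ⟩
    termCoeff n m j * πs (r ℕ.+ j) bs n                          ≡⟨ cong₂ _*_ (termCoeff-split n m j j≤m) (πs-+ bs j n) ⟩
    κ * expCoeff j * π⋆ bs (ℓ^ j) n                            ≡⟨ *-assoc κ (expCoeff j) _ ⟩
    κ * (expCoeff j * π⋆ bs (ℓ^ j) n)                          ∎
    where comps = compositions (r ℕ.+ j) n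

allOnes⊎topCoeffs≡0 : ∀ {bs} → All (1 ≤_) bs →
  (sum bs ≡ length bs × product (map _! bs) ≡ 1 × topCoeffs bs ≡ 1ℚ) ⊎ (sum bs ≢ length bs × topCoeffs bs ≡ 0ℚ)
allOnes⊎topCoeffs≡0 [] = inj₁ (refl , refl , refl)
allOnes⊎topCoeffs≡0 {suc zero ∷ bs} (_ ∷ bs≥1) with allOnes⊎topCoeffs≡0 bs≥1
... | inj₁ (Σ≡r , ∏!≡1 , top≡1) = inj₁ (cong suc Σ≡r , trans (ℕP.+-identityʳ _) ∏!≡1 , trans (*-identityˡ _) top≡1)
... | inj₂ (Σ≢r , top≡0) = inj₂ (Σ≢r ∘ ℕP.suc-injective , trans (*-identityˡ _) top≡0)
allOnes⊎topCoeffs≡0 {suc (suc b) ∷ bs} (_ ∷ bs≥1) = inj₂ (Σ≢r , *-zeroˡ (topCoeffs bs))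
  where
  Σ≢r : suc (suc b ℕ.+ sum bs) ≢ suc (length bs)
  Σ≢r eq = ℕP.<-irrefl refl (ℕP.≤-trans (s≤s (ℕP.m≤n+m (sum bs) b))
                                        (ℕP.≤-trans (ℕP.≤-reflexive (ℕP.suc-injective eq)) (length≤sum bs≥1)))

δ-≡ : ∀ {n r} → n ≡ r → δ n r ≡ 1ℚ
δ-≡ {n} {r} n≡r with n ℕP.≟ r
... | yes _ = refl
... | no n≢r = ⊥-elim (n≢r n≡r)

δ-≢ : ∀ {n r} → n ≢ r → δ n r ≡ 0ℚ
δ-≢ {n} {r} n≢r with n ℕP.≟ r
... | yes n≡r = ⊥-elim (n≢r n≡r)
... | no _ = refl

lhs≡δ : ∀ n bs .{{_ : ℕ.NonZero n}} → All (1 ≤_) bs → sum bs ≡ n → lhs n (length bs) bs ≡ δ n (length bs)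
lhs≡δ n bs bs≥1 Σbs≡n =
  trans (cong (multinomial n bs *_) (kSum≡prefactor*topCoeffs n bs bs≥1 Σbs≡n)) (evaluate (allOnes⊎topCoeffs≡0 bs≥1))
  where
  open ≡-Reasoning
  r = length bs
  evaluate : (sum bs ≡ r × product (map _! bs) ≡ 1 × topCoeffs bs ≡ 1ℚ) ⊎ (sum bs ≢ r × topCoeffs bs ≡ 0ℚ) →
    multinomial n bs * (prefactor n (n ∸ r) * topCoeffs bs) ≡ δ n r
  evaluate (inj₁ (Σbs≡r , ∏b!≡1 , top≡1)) = begin
    multinomial n bs * (prefactor n (n ∸ r) * topCoeffs bs)
      ≡⟨ cong₂ (λ p q → ℕ→ℚ (n !) * inv (ℕ→ℚ p) * (prefactor n q * topCoeffs bs)) ∏b!≡1 n∸r≡0 ⟩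
    ℕ→ℚ (n !) * 1ℚ * (prefactor n 0 * topCoeffs bs)       ≡⟨ cong₂ (λ p q → ℕ→ℚ (n !) * 1ℚ * (p * q)) (prefactor-zero n) top≡1 ⟩
    ℕ→ℚ (n !) * 1ℚ * (inv (ℕ→ℚ (n !)) * 1ℚ)              ≡⟨ solve 2 (λ a b → a :* con 1ℚ :* (b :* con 1ℚ) := a :* b) refl (ℕ→ℚ (n !)) (inv (ℕ→ℚ (n !))) ⟩
    ℕ→ℚ (n !) * inv (ℕ→ℚ (n !))                          ≡⟨ ℕ→ℚ-*-inv (n !) {{ℕP._!≢0 n}} ⟩
    1ℚ                                                    ≡⟨ sym (δ-≡ n≡r) ⟩
    δ n r                                                 ∎
    where
    n≡r = trans (sym Σbs≡n) Σbs≡r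
    n∸r≡0 = trans (cong (n ∸_) (sym n≡r)) (ℕP.n∸n≡0 n)
  evaluate (inj₂ (Σbs≢r , top≡0)) = begin
    multinomial n bs * (prefactor n (n ∸ r) * topCoeffs bs)  ≡⟨ cong (λ q → multinomial n bs * (prefactor n (n ∸ r) * q)) top≡0 ⟩
    multinomial n bs * (prefactor n (n ∸ r) * 0ℚ)            ≡⟨ cong (multinomial n bs *_) (*-zeroʳ (prefactor n (n ∸ r))) ⟩
    multinomial n bs * 0ℚ                                    ≡⟨ *-zeroʳ (multinomial n bs) ⟩
    0ℚ                                                       ≡⟨ sym (δ-≢ (Σbs≢r ∘ trans Σbs≡n)) ⟩
    δ n r                                                    ∎

sum-toList : ∀ {r} (b : Vec ℕ r) → Vec.sum b ≡ sum (toList b)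
sum-toList Vec.[] = refl
sum-toList (x Vec.∷ b) = cong (x ℕ.+_) (sum-toList b)

theorem1 : (n r : ℕ) → 1 ≤ r → r ≤ n → (b : Vec ℕ r) → VecAll.All (1 ≤_) b → Vec.sum b ≡ n →
    lhs n r (toList b) ≡ δ n r
theorem1 zero r 1≤r r≤0 = ⊥-elim (ℕP.<-irrefl refl (ℕP.≤-trans 1≤r r≤0))
theorem1 n@(suc _) r _ _ b b≥1 Σb≡n =
  subst (λ r → lhs n r (toList b) ≡ δ n r) (length-toList b)
    (lhs≡δ n (toList b) (toList⁺ b≥1) (trans (sym (sum-toList b)) Σb≡n))
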